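{- Let $T$ be a tree of order $n\geq 9$ and let $\overline{T}$ be its complement. Then $\mathrm{mp}(T)=\mathrm{mp}(\overline{T})=0$ if and only if $n$ is even and $T=K_{1,n-1}$.
   Context: All graphs are finite, simple and undirected; $\overline{T}$ is the complement of $T$ and $K_{1,n-1}$ is the star on $n$ vertices. A perfect matching is a set of edges covering every vertex exactly once; an almost-perfect matching is a set of edges covering every vertex except one exactly once and missing the remaining vertex. The matching preclusion number $\mathrm{mp}(G)$ is the minimum number of edges whose deletion leaves a graph with neither a perfect matching nor an almost-perfect matching ($\mathrm{mp}(G)=0$ if $G$ has neither). -}

module Defs where

open import Data.Nat using (ℕ; zero; suc; _+_; _<ᵇ_; _≤_)
open import Data.Nat.Divisibility using (_∣_)
open import Data.Fin using (Fin; toℕ; _≟_) renaming (zero to fz; suc to fs)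
open import Data.Bool using (Bool; true; false; not; _∧_; if_then_else_)
open import Data.Maybe using (Maybe; just; nothing)
open import Data.Product using (Σ; _×_; _,_; ∃)
open import Data.Sum using (_⊎_)
open import Relation.Nullary using (¬_; does; yes; no)
open import Relation.Binary.PropositionalEquality using (_≡_; _≢_; refl; sym; cong; cong₂)
open import Function.Bundles using (_↔_; Inverse)

record Graph (n : ℕ) : Set where
  field
    adj    : Fin n → Fin n → Bool
    adjSym : ∀ i j → adj i j ≡ adj j i
    adjIrr : ∀ i → adj i i ≡ false
open Graph public

Adj : ∀ {n} → Graph n → Fin n → Fin n → Set
Adj G i j = adj G i j ≡ true

private
  eqb : ∀ {n} → Fin n → Fin n → Bool
  eqb i j = does (i ≟ j)

  eqb-sym : ∀ {n} (i j : Fin n) → eqb i j ≡ eqb j i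
  eqb-sym i j with i ≟ j | j ≟ i
  ... | yes _ | yes _ = refl
  ... | no _  | no _  = refl
  ... | yes p | no q  = Data.Empty.⊥-elim (q (sym p))
    where import Data.Empty
  ... | no p  | yes q = Data.Empty.⊥-elim (p (sym q))
    where import Data.Empty

  eqb-refl : ∀ {n} (i : Fin n) → eqb i i ≡ true
  eqb-refl i with i ≟ i
  ... | yes _ = refl
  ... | no p  = Data.Empty.⊥-elim (p refl)
    where import Data.Empty

complement : ∀ {n} → Graph n → Graph n
complement {n} G = record
  { adj    = λ i j → not (adj G i j) ∧ not (eqb i j)
  ; adjSym = λ i j → cong₂ (λ a b → not a ∧ not b) (adjSym G i j) (eqb-sym i j)
  ; adjIrr = λ i → lemma (adj G i i) (eqb-refl i)
  }
  where
  lemma : ∀ (a : Bool) {b : Bool} → b ≡ true → not a ∧ not b ≡ false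
  lemma false refl = refl
  lemma true  refl = refl

data Walk {n} (G : Graph n) : Fin n → Fin n → Set where
  here : ∀ {u} → Walk G u u
  step : ∀ {u v w} → Adj G u v → Walk G v w → Walk G u w

Connected : ∀ {n} → Graph n → Set
Connected G = ∀ u v → Walk G u v

private
  nextFin : ∀ {k} → Fin (suc k) → Fin (suc k)
  nextFin {k} i = Data.Fin.fromℕ< {suc (toℕ i) Data.Nat.% suc k}
                    (Data.Nat.DivMod.m%n<n (suc (toℕ i)) (suc k))
    where import Data.Fin ; import Data.Nat ; import Data.Nat.DivMod

record Cycle {n} (G : Graph n) : Set where
  field
    k     : ℕ
    c     : Fin (3 + k) → Fin n
    inj   : ∀ i j → c i ≡ c j → i ≡ j
    edges : ∀ i → Adj G (c i) (c (nextFin i))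

Acyclic : ∀ {n} → Graph n → Set
Acyclic G = ¬ Cycle G

IsTree : ∀ {n} → Graph n → Set
IsTree G = Connected G × Acyclic G

-- The star K_{1,n-1} on Fin (suc m): centre fz, leaves fs _.

private
  isZ : ∀ {n} → Fin n → Bool
  isZ fz     = true
  isZ (fs _) = false

  xor : Bool → Bool → Bool
  xor true  b = not b
  xor false b = b

  xor-comm : ∀ a b → xor a b ≡ xor b a
  xor-comm true true = refl
  xor-comm true false = refl
  xor-comm false true = refl
  xor-comm false false = refl

  xor-self : ∀ a → xor a a ≡ false
  xor-self true = refl
  xor-self false = refl

star : (m : ℕ) → Graph (suc m)
star m = record
  { adj    = λ i j → xor (isZ i) (isZ j)
  ; adjSym = λ i j → xor-comm (isZ i) (isZ j)
  ; adjIrr = λ i → xor-self (isZ i)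
  }

_≅_ : ∀ {n} → Graph n → Graph n → Set
_≅_ {n} G H = Σ (Fin n ↔ Fin n) λ σ →
  ∀ i j → adj G i j ≡ adj H (Inverse.to σ i) (Inverse.to σ j)

-- m v ≡ just w means the edge vw is in the matching; m v ≡ nothing
-- means v is not covered.
record Matching {n} (a : Fin n → Fin n → Bool) : Set where
  field
    partner  : Fin n → Maybe (Fin n)
    isEdge   : ∀ v w → partner v ≡ just w → a v w ≡ true
    involut  : ∀ v w → partner v ≡ just w → partner w ≡ just v
open Matching public

Covered : ∀ {n} {a : Fin n → Fin n → Bool} → Matching a → Fin n → Set
Covered M v = ∃ λ w → partner M v ≡ just w

IsPerfect : ∀ {n} {a : Fin n → Fin n → Bool} → Matching a → Set
IsPerfect M = ∀ v → Covered M v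

IsAlmostPerfect : ∀ {n} {a : Fin n → Fin n → Bool} → Matching a → Set
IsAlmostPerfect {n} M = ∃ λ (u : Fin n) →
  partner M u ≡ nothing × (∀ v → v ≢ u → Covered M v)

HasPM : ∀ {n} → (Fin n → Fin n → Bool) → Set
HasPM a = ∃ λ (M : Matching a) → IsPerfect M

HasAPM : ∀ {n} → (Fin n → Fin n → Bool) → Set
HasAPM a = ∃ λ (M : Matching a) → IsAlmostPerfect M

NoPMnorAPM : ∀ {n} → (Fin n → Fin n → Bool) → Set
NoPMnorAPM a = ¬ HasPM a × ¬ HasAPM a

record EdgeSet {n} (G : Graph n) : Set where
  field
    mem    : Fin n → Fin n → Bool
    memSym : ∀ i j → mem i j ≡ mem j i
    memSub : ∀ i j → mem i j ≡ true → adj G i j ≡ true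
open EdgeSet public

sumFin : (n : ℕ) → (Fin n → ℕ) → ℕ
sumFin zero    f = 0
sumFin (suc n) f = f fz + sumFin n (λ i → f (fs i))

size : ∀ {n} {G : Graph n} → EdgeSet G → ℕ
size {n} F = sumFin n λ i → sumFin n λ j →
  if (toℕ i <ᵇ toℕ j) ∧ mem F i j then 1 else 0

deleteEdges : ∀ {n} (G : Graph n) → EdgeSet G → Fin n → Fin n → Bool
deleteEdges G F i j = adj G i j ∧ not (mem F i j)

IsMP : ∀ {n} → Graph n → ℕ → Set
IsMP G k =
  (∃ λ (F : EdgeSet G) → size F ≡ k × NoPMnorAPM (deleteEdges G F))
  × (∀ (F : EdgeSet G) → NoPMnorAPM (deleteEdges G F) → k ≤ size F)

Even : ℕ → Set
Even n = 2 ∣ n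

module Submission where

-- mp(G) = 0 says exactly that G has neither a perfect nor an
-- almost-perfect matching (mp-zero⇔noMatching), so the statement is
-- about matchings of T and T̄.
--
-- * Parity: matched vertices come in pairs, so a graph of even order has
--   no almost-perfect matching, and a matching missing exactly two
--   vertices only exists in a graph of even order.
-- * Pairings: lists of disjoint pairs of non-adjacent vertices of G are
--   matchings of the complement; an independent set can be paired up
--   greedily with at most one vertex left over.
-- * The core (NearPerfect): if G has no triangles and no 4-cycles, then
--   its complement has a matching missing at most one vertex, or G has a
--   vertex adjacent to all others.  By induction on the vertices: two
--   new adjacent vertices are absorbed into the pairing by swapping one
--   or two pairs, which fails only if one of them dominates.
-- * Stars: in a tree a dominating vertex is a star centre; a star with
--   two leaves has no perfect matching, nor has its complement (whose
--   centre is isolated), and that complement, a clique on the leaves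
--   plus an isolated centre, has an almost-perfect matching if n is odd.
--
-- The theorem follows: forward, T̄ has no matching of either kind, so T
-- is a star and n is even; backward, neither T nor T̄ has a perfect
-- matching and n even excludes almost-perfect ones.

open import Defs
open import Data.Nat using (ℕ; zero; suc; _≤_; z≤n; s≤s; _+_; _<_; _<ᵇ_)
open import Data.Nat.Properties using (suc-injective; +-suc; +-comm; <⇒<ᵇ; <-cmp; 0≢1+n)
open import Data.Nat.Divisibility
  using (_∣_; _∣0; ∣-refl; ∣m∣n⇒∣m+n; ∣m+n∣m⇒∣n; ∣1⇒≡1)
open import Data.Fin using (Fin; toℕ; _≟_) renaming (zero to fz; suc to fs)
open import Data.Fin.Properties using (toℕ-injective; any?)
import Data.Fin.Properties as Fin
open import Data.Fin.Permutation using (transpose)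
import Data.Fin.Permutation.Components as PC
open import Data.Bool using (Bool; true; false; not; _∧_; if_then_else_; T)
import Data.Bool as Bool
open import Data.Bool.Properties using (∧-conicalˡ; ¬-not; ∧-identityʳ; ∧-zeroʳ)
open import Data.Maybe using (Maybe; just; nothing)
open import Data.Maybe.Properties using (just-injective)
open import Data.Product using (Σ; ∃; _×_; _,_; proj₁; proj₂; map₁; map₂)
open import Data.Sum using (_⊎_; inj₁; inj₂)
open import Data.Empty using (⊥; ⊥-elim)
open import Data.Unit using (⊤; tt)
open import Data.List using (List; []; _∷_; allFin)
open import Data.List.Membership.Propositional using (_∈_; _∉_)
open import Data.List.Membership.Propositional.Properties using (∈-allFin)
open import Data.List.Relation.Unary.Any using (here; there)
open import Data.List.Relation.Unary.All.Properties using (All¬⇒¬Any)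
open import Data.List.Relation.Unary.AllPairs using ([]; _∷_)
open import Data.List.Relation.Unary.Unique.Propositional using (Unique)
open import Data.List.Relation.Unary.Unique.Propositional.Properties using (allFin⁺)
open import Relation.Nullary using (¬_; yes; no; does)
open import Relation.Nullary.Decidable using (dec-true; dec-false; dec-yes; dec-no)
open import Relation.Binary using (tri<; tri≈; tri>)
open import Relation.Binary.PropositionalEquality
open import Function.Bundles using (_⇔_; mk⇔; _↔_; Inverse; Equivalence)

true≢false : true ≢ false
true≢false ()

nothing≢just : ∀ {A : Set} {a : A} → nothing ≢ just a
nothing≢just ()

≢true⇒false : ∀ {b} → b ≢ true → b ≡ false
≢true⇒false = ¬-not {y = true}

Even-2+ : ∀ {k} → Even k → Even (suc (suc k))
Even-2+ = ∣m∣n⇒∣m+n ∣-refl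

¬Even-both : ∀ m → Even m → Even (suc m) → ⊥
¬Even-both m 2∣m 2∣1+m with ∣1⇒≡1 (∣m+n∣m⇒∣n (subst (2 ∣_) (+-comm 1 m) 2∣1+m) 2∣m)
... | ()

adjacent-≢ : ∀ {n} (G : Graph n) {a b} → Adj G a b → a ≢ b
adjacent-≢ G {a} ab refl = true≢false (trans (sym ab) (adjIrr G a))

complement-adj : ∀ {n} (G : Graph n) a b → a ≢ b → adj G a b ≡ false → Adj (complement G) a b
complement-adj G a b a≢b ¬ab rewrite ¬ab | dec-false (a ≟ b) a≢b = refl

complement-nonadj : ∀ {n} (G : Graph n) a b → Adj G a b → adj (complement G) a b ≡ false
complement-nonadj G a b ab rewrite ab = refl

sumFin-cong : ∀ n {f g : Fin n → ℕ} → (∀ i → f i ≡ g i) → sumFin n f ≡ sumFin n g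
sumFin-cong zero    f≗g = refl
sumFin-cong (suc n) f≗g = cong₂ _+_ (f≗g fz) (sumFin-cong n (λ i → f≗g (fs i)))

sumFin-zero : ∀ n {f : Fin n → ℕ} → (∀ i → f i ≡ 0) → sumFin n f ≡ 0
sumFin-zero zero    f≗0 = refl
sumFin-zero (suc n) f≗0 rewrite f≗0 fz = sumFin-zero n (λ i → f≗0 (fs i))

sumFin-zero⁻ : ∀ n {f : Fin n → ℕ} → sumFin n f ≡ 0 → ∀ i → f i ≡ 0
sumFin-zero⁻ (suc n) {f} sum≡0 fz with f fz
... | zero = refl
sumFin-zero⁻ (suc n) {f} sum≡0 (fs i) with f fz
... | zero = sumFin-zero⁻ n sum≡0 i

indicator : Bool → ℕ
indicator b = if b then 1 else 0

count : ∀ {n} → (Fin n → Bool) → ℕ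
count {n} S = sumFin n (λ i → indicator (S i))

count-all : ∀ n → count {n} (λ _ → true) ≡ n
count-all zero    = refl
count-all (suc n) = cong suc (count-all n)

count-none : ∀ {n} (S : Fin n → Bool) → (∀ v → S v ≢ true) → count S ≡ 0
count-none {n} S none = sumFin-zero n (λ i → cong indicator (≢true⇒false (none i)))

remove : ∀ {n} → (Fin n → Bool) → Fin n → Fin n → Bool
remove S v u = S u ∧ not (does (u ≟ v))

remove-sound : ∀ {n} (S : Fin n → Bool) v {u} → remove S v u ≡ true → S u ≡ true × u ≢ v
remove-sound S v {u} removed with u ≟ v
... | yes _ rewrite ∧-zeroʳ (S u) = ⊥-elim (true≢false (sym removed))
... | no u≢v = ∧-conicalˡ (S u) true removed , u≢v

remove-complete : ∀ {n} (S : Fin n → Bool) v {u} → S u ≡ true → u ≢ v → remove S v u ≡ true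
remove-complete S v {u} Su u≢v rewrite Su | dec-false (u ≟ v) u≢v = refl

count-remove : ∀ {n} (S : Fin n → Bool) v → S v ≡ true → count S ≡ suc (count (remove S v))
count-remove {suc n} S fz Sv rewrite Sv =
  cong suc (sumFin-cong n (λ i → cong indicator (sym (∧-identityʳ (S (fs i))))))
count-remove {suc n} S (fs v) Sv = begin
  indicator (S fz) + count (λ i → S (fs i))
    ≡⟨ cong (indicator (S fz) +_) (count-remove (λ i → S (fs i)) v Sv) ⟩
  indicator (S fz) + suc (count (remove (λ i → S (fs i)) v))
    ≡⟨ +-suc (indicator (S fz)) _ ⟩
  suc (indicator (S fz) + count (remove (λ i → S (fs i)) v))
    ≡⟨ cong (λ b → suc (indicator b + count (remove (λ i → S (fs i)) v))) (sym (∧-identityʳ (S fz))) ⟩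
  suc (count (remove S (fs v))) ∎
  where open ≡-Reasoning

count-nonempty : ∀ {n} (S : Fin n → Bool) {k} → count S ≡ suc k → ∃ λ v → S v ≡ true
count-nonempty S count≡ with any? (λ v → S v Bool.≟ true)
... | yes found = found
... | no none = ⊥-elim (0≢1+n (trans (sym (count-none S (λ v Sv → none (v , Sv)))) count≡))

module MatchedParity {n} (G : Graph n) (M : Matching (adj G)) where

  partner-≢ : ∀ v w → partner M v ≡ just w → v ≢ w
  partner-≢ v w pv refl = true≢false (trans (sym (isEdge M v v pv)) (adjIrr G v))

  Closed : (Fin n → Bool) → Set
  Closed S = ∀ v w → S v ≡ true → partner M v ≡ just w → S w ≡ true

  AllMatched : (Fin n → Bool) → Set
  AllMatched S = ∀ v → S v ≡ true → Covered M v

  removePair : ∀ S → Closed S → AllMatched S → ∀ v → S v ≡ true →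
    Σ (Fin n → Bool) λ S′ → count S ≡ suc (suc (count S′)) × Closed S′ × AllMatched S′
  removePair S closed matched v Sv with matched v Sv
  ... | w , pv = remove S₋ w , shrink , closed′ , matched′
    where
    S₋ = remove S v
    S₋w : S₋ w ≡ true
    S₋w = remove-complete S v (closed v w Sv pv) (λ w≡v → partner-≢ v w pv (sym w≡v))
    shrink : count S ≡ suc (suc (count (remove S₋ w)))
    shrink = trans (count-remove S v Sv) (cong suc (count-remove S₋ w S₋w))
    closed′ : Closed (remove S₋ w)
    closed′ u u′ S′u pu with remove-sound S₋ w S′u
    ... | S₋u , u≢w with remove-sound S v S₋u
    ... | Su , u≢v = remove-complete S₋ w (remove-complete S v (closed u u′ Su pu) u′≢v) u′≢w
      where
      u′≢v : u′ ≢ v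
      u′≢v refl = u≢w (just-injective (trans (sym (involut M u v pu)) pv))
      u′≢w : u′ ≢ w
      u′≢w refl = u≢v (just-injective (trans (sym (involut M u w pu)) (involut M v w pv)))
    matched′ : AllMatched (remove S₋ w)
    matched′ u S′u = matched u (proj₁ (remove-sound S v (proj₁ (remove-sound S₋ w S′u))))

  closed-even : ∀ k S → count S ≡ k → Closed S → AllMatched S → Even k
  closed-even zero S _ _ _ = 2 ∣0
  closed-even (suc k) S count≡ closed matched
    with removePair S closed matched _ (proj₂ (count-nonempty S count≡))
  ... | S′ , shrink , closed′ , matched′ with trans (sym count≡) shrink
  closed-even (suc zero) S _ _ _ | _ | ()
  closed-even (suc (suc k)) S _ _ _ | S′ , _ , closed′ , matched′ | k≡ =
    Even-2+ (closed-even k S′ (sym (suc-injective (suc-injective k≡))) closed′ matched′)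

  matched-even : ∀ S → (∀ v → S v ≡ true → Covered M v) → (∀ v → Covered M v → S v ≡ true) →
    Even (count S)
  matched-even S sound complete = closed-even (count S) S refl closed sound
    where
    closed : Closed S
    closed v w _ pv = complete w (v , involut M v w pv)

open MatchedParity using (matched-even)

covered≢unmatched : ∀ {n} {a : Fin n → Fin n → Bool} (M : Matching a) {u v} →
  partner M u ≡ nothing → Covered M v → v ≢ u
covered≢unmatched M pu (w , pv) refl = nothing≢just (trans (sym pu) pv)

almostPerfect⇒odd : ∀ {m} (G : Graph (suc m)) → HasAPM (adj G) → Even m
almostPerfect⇒odd {m} G (M , u , pu , covered) =
  subst Even (suc-injective S-count) (matched-even G M S sound complete)
  where
  S = remove (λ _ → true) u
  sound : ∀ v → S v ≡ true → Covered M v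
  sound v Sv = covered v (proj₂ (remove-sound (λ _ → true) u Sv))
  complete : ∀ v → Covered M v → S v ≡ true
  complete v v-covered = remove-complete (λ _ → true) u refl (covered≢unmatched M pu v-covered)
  S-count : suc (count S) ≡ suc m
  S-count = trans (sym (count-remove (λ _ → true) u refl)) (count-all (suc m))

even⇒noAPM : ∀ {m} → Even (suc m) → (G : Graph (suc m)) → ¬ HasAPM (adj G)
even⇒noAPM {m} even G apm = ¬Even-both m (almostPerfect⇒odd G apm) even

missingTwo⇒even : ∀ {m} (G : Graph (suc m)) (M : Matching (adj G)) c z → z ≢ c →
  partner M c ≡ nothing → partner M z ≡ nothing → (∀ v → v ≢ c → v ≢ z → Covered M v) → Even (suc m)
missingTwo⇒even {m} G M c z z≢c pc pz covered =
  subst Even S-count (Even-2+ (matched-even G M S sound complete))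
  where
  S₁ = remove (λ _ → true) c
  S  = remove S₁ z
  sound : ∀ v → S v ≡ true → Covered M v
  sound v Sv with remove-sound S₁ z Sv
  ... | S₁v , v≢z = covered v (proj₂ (remove-sound (λ _ → true) c S₁v)) v≢z
  complete : ∀ v → Covered M v → S v ≡ true
  complete v v-covered =
    remove-complete S₁ z (remove-complete (λ _ → true) c refl (covered≢unmatched M pc v-covered))
                         (covered≢unmatched M pz v-covered)
  S-count : suc (suc (count S)) ≡ suc m
  S-count = begin
    suc (suc (count S)) ≡⟨ cong suc (count-remove S₁ z (remove-complete (λ _ → true) c refl z≢c)) ⟨
    suc (count S₁)      ≡⟨ count-remove (λ _ → true) c refl ⟨
    count {suc m} (λ _ → true) ≡⟨ count-all (suc m) ⟩
    suc m ∎
    where open ≡-Reasoning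

mapMatching : ∀ {n} {a b : Fin n → Fin n → Bool} → (∀ i j → a i j ≡ true → b i j ≡ true) →
  Matching a → Matching b
mapMatching a⊆b M = record
  { partner = partner M
  ; isEdge  = λ v w pv → a⊆b v w (isEdge M v w pv)
  ; involut = involut M
  }

noMatching-antimono : ∀ {n} {a b : Fin n → Fin n → Bool} → (∀ i j → a i j ≡ true → b i j ≡ true) →
  NoPMnorAPM b → NoPMnorAPM a
noMatching-antimono a⊆b (noPM , noAPM) =
  (λ (M , perfect) → noPM (mapMatching a⊆b M , perfect)) ,
  (λ (M , almostPerfect) → noAPM (mapMatching a⊆b M , almostPerfect))

-- An edge set of size 0 is empty: first for pairs i < j, which are the
-- ones counted by size, then for all pairs by symmetry.
size-zero⇒ordered-empty : ∀ {n} {G : Graph n} (F : EdgeSet G) → size F ≡ 0 →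
  ∀ i j → toℕ i < toℕ j → mem F i j ≡ false
size-zero⇒ordered-empty {n} F size≡0 i j i<j =
  term-zero _ _ (sumFin-zero⁻ n {term i} (sumFin-zero⁻ n {λ i → sumFin n (term i)} size≡0 i) j) (<⇒<ᵇ i<j)
  where
  term : Fin n → Fin n → ℕ
  term i j = indicator ((toℕ i <ᵇ toℕ j) ∧ mem F i j)
  term-zero : ∀ b c → indicator (b ∧ c) ≡ 0 → T b → c ≡ false
  term-zero true false _ _ = refl

size-zero⇒empty : ∀ {n} {G : Graph n} (F : EdgeSet G) → size F ≡ 0 → ∀ i j → i ≢ j → mem F i j ≡ false
size-zero⇒empty F size≡0 i j i≢j with <-cmp (toℕ i) (toℕ j)
... | tri< i<j _ _ = size-zero⇒ordered-empty F size≡0 i j i<j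
... | tri≈ _ i≡j _ = ⊥-elim (i≢j (toℕ-injective i≡j))
... | tri> _ _ j<i = trans (memSym F i j) (size-zero⇒ordered-empty F size≡0 j i j<i)

emptyEdgeSet : ∀ {n} (G : Graph n) → EdgeSet G
emptyEdgeSet G = record { mem = λ _ _ → false ; memSym = λ _ _ → refl ; memSub = λ _ _ () }

size-empty : ∀ {n} (G : Graph n) → size (emptyEdgeSet G) ≡ 0
size-empty {n} G = sumFin-zero n (λ i → sumFin-zero n (λ j → cong indicator (∧-zeroʳ _)))

mp-zero⇔noMatching : ∀ {n} (G : Graph n) → IsMP G 0 ⇔ NoPMnorAPM (adj G)
mp-zero⇔noMatching G = mk⇔ to from
  where
  to : IsMP G 0 → NoPMnorAPM (adj G)
  to ((F , size≡0 , noMatching) , _) = noMatching-antimono kept noMatching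
    where
    kept : ∀ i j → Adj G i j → deleteEdges G F i j ≡ true
    kept i j ij rewrite ij | size-zero⇒empty F size≡0 i j (adjacent-≢ G ij) = refl
  from : NoPMnorAPM (adj G) → IsMP G 0
  from noMatching =
    (emptyEdgeSet G , size-empty G , noMatching-antimono (λ i j → ∧-conicalˡ _ _) noMatching) , λ _ _ → z≤n

-- A
-- valid pairing is a list of disjoint pairs of distinct, non-adjacent
-- vertices; it is the same thing as a matching of the complement.
module Pairings {N : ℕ} (G : Fin N → Fin N → Bool) (G-sym : ∀ a b → G a b ≡ G b a) where

  Pairing : Set
  Pairing = List (Fin N × Fin N)

  infix 4 _∈ᴾ_ _∉ᴾ_

  _∈ᴾ_ : Fin N → Pairing → Set
  v ∈ᴾ []            = ⊥
  v ∈ᴾ ((a , b) ∷ P) = v ≡ a ⊎ v ≡ b ⊎ v ∈ᴾ P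

  _∉ᴾ_ : Fin N → Pairing → Set
  v ∉ᴾ P = ¬ (v ∈ᴾ P)

  Valid : Pairing → Set
  Valid []            = ⊤
  Valid ((a , b) ∷ P) = a ≢ b × a ∉ᴾ P × b ∉ᴾ P × G a b ≡ false × Valid P

  ∉ᴾ-∷ : ∀ {v a b P} → v ≢ a → v ≢ b → v ∉ᴾ P → v ∉ᴾ ((a , b) ∷ P)
  ∉ᴾ-∷ v≢a v≢b v∉P (inj₁ v≡a)        = v≢a v≡a
  ∉ᴾ-∷ v≢a v≢b v∉P (inj₂ (inj₁ v≡b)) = v≢b v≡b
  ∉ᴾ-∷ v≢a v≢b v∉P (inj₂ (inj₂ v∈P)) = v∉P v∈P

  partnerIn : Pairing → Fin N → Maybe (Fin N)
  partnerIn []            v = nothing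
  partnerIn ((a , b) ∷ P) v with v ≟ a
  ... | yes _ = just b
  ... | no _ with v ≟ b
  ...   | yes _ = just a
  ...   | no _  = partnerIn P v

  partnerIn-∈ : ∀ P v → v ∈ᴾ P → ∃ λ w → partnerIn P v ≡ just w
  partnerIn-∈ ((a , b) ∷ P) v v∈ with v ≟ a
  ... | yes _ = b , refl
  ... | no v≢a with v ≟ b
  ...   | yes _ = a , refl
  ...   | no v≢b = partnerIn-∈ P v (lemma v∈)
    where
    lemma : v ∈ᴾ ((a , b) ∷ P) → v ∈ᴾ P
    lemma (inj₁ v≡a)        = ⊥-elim (v≢a v≡a)
    lemma (inj₂ (inj₁ v≡b)) = ⊥-elim (v≢b v≡b)
    lemma (inj₂ (inj₂ v∈P)) = v∈P

  partnerIn-∉ : ∀ P v → v ∉ᴾ P → partnerIn P v ≡ nothing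
  partnerIn-∉ []            v _   = refl
  partnerIn-∉ ((a , b) ∷ P) v v∉ with v ≟ a
  ... | yes v≡a = ⊥-elim (v∉ (inj₁ v≡a))
  ... | no _ with v ≟ b
  ...   | yes v≡b = ⊥-elim (v∉ (inj₂ (inj₁ v≡b)))
  ...   | no _    = partnerIn-∉ P v (λ v∈P → v∉ (inj₂ (inj₂ v∈P)))

  partnerIn-occurs : ∀ P v w → partnerIn P v ≡ just w → v ∈ᴾ P × w ∈ᴾ P
  partnerIn-occurs ((a , b) ∷ P) v w pv with v ≟ a
  partnerIn-occurs ((a , b) ∷ P) v w refl | yes v≡a = inj₁ v≡a , inj₂ (inj₁ refl)
  ... | no _ with v ≟ b
  partnerIn-occurs ((a , b) ∷ P) v w refl | no _ | yes v≡b = inj₂ (inj₁ v≡b) , inj₁ refl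
  ...   | no _ with partnerIn-occurs P v w pv
  ...     | v∈P , w∈P = inj₂ (inj₂ v∈P) , inj₂ (inj₂ w∈P)

  partnerIn-nonadjacent : ∀ P → Valid P → ∀ v w → partnerIn P v ≡ just w → v ≢ w × G v w ≡ false
  partnerIn-nonadjacent ((a , b) ∷ P) (a≢b , _ , _ , ¬ab , valid) v w pv with v ≟ a
  partnerIn-nonadjacent ((a , b) ∷ P) (a≢b , _ , _ , ¬ab , valid) v w refl | yes refl = a≢b , ¬ab
  ... | no _ with v ≟ b
  partnerIn-nonadjacent ((a , b) ∷ P) (a≢b , _ , _ , ¬ab , valid) v w refl | no _ | yes refl =
    (λ b≡a → a≢b (sym b≡a)) , trans (G-sym b a) ¬ab
  ...   | no _ = partnerIn-nonadjacent P valid v w pv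

  partnerIn-involutive : ∀ P → Valid P → ∀ v w → partnerIn P v ≡ just w → partnerIn P w ≡ just v
  partnerIn-involutive ((a , b) ∷ P) (a≢b , a∉ , b∉ , _ , valid) v w pv with v ≟ a
  partnerIn-involutive ((a , b) ∷ P) (a≢b , _ , _ , _ , _) v w refl | yes refl
    rewrite dec-no (w ≟ v) (λ w≡v → a≢b (sym w≡v)) | proj₂ (dec-yes (w ≟ w) refl) = refl
  ... | no v≢a with v ≟ b
  partnerIn-involutive ((a , b) ∷ P) _ v w refl | no _ | yes refl
    rewrite proj₂ (dec-yes (w ≟ w) refl) = refl
  ...   | no v≢b with partnerIn-occurs P v w pv
  ...     | _ , w∈P rewrite dec-no (w ≟ a) (λ { refl → a∉ w∈P }) | dec-no (w ≟ b) (λ { refl → b∉ w∈P }) =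
    partnerIn-involutive P valid v w pv

  toMatching : ∀ {R : Fin N → Fin N → Bool} → (∀ a b → a ≢ b → G a b ≡ false → R a b ≡ true) →
    ∀ P → Valid P → Matching R
  toMatching R⊇ P valid = record
    { partner = partnerIn P
    ; isEdge  = λ v w pv → let (v≢w , ¬vw) = partnerIn-nonadjacent P valid v w pv in R⊇ v w v≢w ¬vw
    ; involut = partnerIn-involutive P valid
    }

  CoversBut : Pairing → List (Fin N) → Fin N → Set
  CoversBut P L w = ∀ v → v ∈ L → v ≢ w → v ∈ᴾ P

  AlmostCoversBut : Pairing → List (Fin N) → Fin N → Set
  AlmostCoversBut P L w = CoversBut P L w
    ⊎ Σ (Fin N) λ z → z ∈ L × z ≢ w × z ∉ᴾ P × (∀ v → v ∈ L → v ≢ w → v ≢ z → v ∈ᴾ P)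

  ∉-∈⇒≢ : ∀ {x z : Fin N} {L} → x ∉ L → z ∈ L → x ≢ z
  ∉-∈⇒≢ x∉L z∈L refl = x∉L z∈L

  head∉tail : ∀ {x : Fin N} {L} → Unique (x ∷ L) → x ∉ L
  head∉tail (x≢L ∷ _) = All¬⇒¬Any x≢L

  within-∷ : ∀ {P w L y} → (∀ v → v ∈ᴾ P → v ∈ L × v ≢ y) → ∀ v → v ∈ᴾ P → v ∈ w ∷ L × v ≢ y
  within-∷ within v v∈P = map₁ there (within v v∈P)

  -- A
  -- new vertex w ≠ y is paired with the left-over vertex, if any, and
  -- otherwise becomes the left-over vertex.
  pairIndependent : ∀ L y → Unique L → (∀ u v → u ∈ L → v ∈ L → u ≢ y → v ≢ y → G u v ≡ false) →
    Σ Pairing λ P → Valid P × (∀ v → v ∈ᴾ P → v ∈ L × v ≢ y) × AlmostCoversBut P L y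
  pairIndependent [] y _ _ = [] , tt , (λ v ()) , inj₁ (λ v ())
  pairIndependent (w ∷ L) y uwL@(_ ∷ uL) indep
    with pairIndependent L y uL (λ u v u∈ v∈ → indep u v (there u∈) (there v∈))
  ... | P , valid , within , almost with w ≟ y | almost
  ...   | yes w≡y | inj₁ all = P , valid , within-∷ within ,
          inj₁ λ where
            v (here v≡w) v≢y → ⊥-elim (v≢y (trans v≡w w≡y))
            v (there v∈) v≢y → all v v∈ v≢y
  ...   | yes w≡y | inj₂ (z , z∈ , z≢y , z∉ , rest) = P , valid , within-∷ within ,
          inj₂ (z , there z∈ , z≢y , z∉ ,
            λ where
              v (here v≡w) v≢y _   → ⊥-elim (v≢y (trans v≡w w≡y))
              v (there v∈) v≢y v≢z → rest v v∈ v≢y v≢z)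
  ...   | no w≢y | inj₁ all = P , valid , within-∷ within ,
          inj₂ (w , here refl , w≢y , (λ w∈P → head∉tail uwL (proj₁ (within w w∈P))) ,
            λ where
              v (here v≡w) _   v≢w → ⊥-elim (v≢w v≡w)
              v (there v∈) v≢y _   → all v v∈ v≢y)
  ...   | no w≢y | inj₂ (z , z∈ , z≢y , z∉ , rest) = ((w , z) ∷ P) , valid′ , within′ , inj₁ covers
    where
    w∉L = head∉tail uwL
    valid′ : Valid ((w , z) ∷ P)
    valid′ = ∉-∈⇒≢ w∉L z∈ , (λ w∈P → w∉L (proj₁ (within w w∈P))) , z∉
           , indep w z (here refl) (there z∈) w≢y z≢y , valid
    within′ : ∀ v → v ∈ᴾ (w , z) ∷ P → v ∈ w ∷ L × v ≢ y
    within′ v (inj₁ refl)        = here refl , w≢y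
    within′ v (inj₂ (inj₁ refl)) = there z∈ , z≢y
    within′ v (inj₂ (inj₂ v∈P))  = within-∷ within v v∈P
    covers : CoversBut ((w , z) ∷ P) (w ∷ L) y
    covers v (here v≡w) _ = inj₁ v≡w
    covers v (there v∈) v≢y with v ≟ z
    ... | yes v≡z = inj₂ (inj₁ v≡z)
    ... | no v≢z  = inj₂ (inj₂ (rest v v∈ v≢y v≢z))

module NearPerfect {N : ℕ} (G : Fin N → Fin N → Bool) (G-sym : ∀ a b → G a b ≡ G b a)
  (triangle-free : ∀ a b c → G a b ≡ true → G b c ≡ true → G c a ≡ true → ⊥)
  (square-free : ∀ a b c d → a ≢ c → b ≢ d →
                 G a b ≡ true → G b c ≡ true → G c d ≡ true → G d a ≡ true → ⊥)
  where

  open Pairings G G-sym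

  Absorbs : Pairing → Fin N → Fin N → Pairing → Set
  Absorbs P x z P′ = Valid P′ × (∀ v → v ∈ᴾ P′ → v ∈ᴾ P ⊎ v ≡ x ⊎ v ≡ z)
                   × (∀ v → v ∈ᴾ P → v ∈ᴾ P′) × x ∈ᴾ P′ × z ∈ᴾ P′

  AdjacentToAll : Fin N → Pairing → Set
  AdjacentToAll y P = ∀ v → v ∈ᴾ P → G y v ≡ true

  AbsorbResult : Pairing → Fin N → Fin N → Set
  AbsorbResult P x z = (Σ Pairing (Absorbs P x z)) ⊎ AdjacentToAll x P ⊎ AdjacentToAll z P

  absorbs-flip : ∀ {P x z P′} → Absorbs P x z P′ → Absorbs P z x P′
  absorbs-flip (valid , back , forth , x∈ , z∈) = valid , (λ v v∈ → reorder (back v v∈)) , forth , z∈ , x∈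
    where
    reorder : ∀ {A B C : Set} → A ⊎ B ⊎ C → A ⊎ C ⊎ B
    reorder (inj₁ a)        = inj₁ a
    reorder (inj₂ (inj₁ b)) = inj₂ (inj₂ b)
    reorder (inj₂ (inj₂ c)) = inj₂ (inj₁ c)

  absorbResult-flip : ∀ {P x z} → AbsorbResult P z x → AbsorbResult P x z
  absorbResult-flip (inj₁ (P′ , absorbs)) = inj₁ (P′ , absorbs-flip absorbs)
  absorbResult-flip (inj₂ (inj₁ adj-z))   = inj₂ (inj₂ adj-z)
  absorbResult-flip (inj₂ (inj₂ adj-x))   = inj₂ (inj₁ adj-x)

  ∈ᴾ-reverseHead : ∀ {v c d Q} → v ∈ᴾ (c , d) ∷ Q → v ∈ᴾ (d , c) ∷ Q
  ∈ᴾ-reverseHead (inj₁ v≡c)        = inj₂ (inj₁ v≡c)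
  ∈ᴾ-reverseHead (inj₂ (inj₁ v≡d)) = inj₁ v≡d
  ∈ᴾ-reverseHead (inj₂ (inj₂ v∈Q)) = inj₂ (inj₂ v∈Q)

  valid-reverseHead : ∀ {c d Q} → Valid ((c , d) ∷ Q) → Valid ((d , c) ∷ Q)
  valid-reverseHead (c≢d , c∉ , d∉ , ¬cd , valid) =
    (λ d≡c → c≢d (sym d≡c)) , d∉ , c∉ , trans (G-sym _ _) ¬cd , valid

  absorbs-reverseHead : ∀ {x z c d Q P′} → Absorbs ((d , c) ∷ Q) x z P′ → Absorbs ((c , d) ∷ Q) x z P′
  absorbs-reverseHead (valid , back , forth , x∈ , z∈) =
    valid , (λ v v∈ → back′ (back v v∈)) , (λ v v∈ → forth v (∈ᴾ-reverseHead v∈)) , x∈ , z∈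
    where
    back′ : ∀ {v c d Q} {B : Set} → v ∈ᴾ (d , c) ∷ Q ⊎ B → v ∈ᴾ (c , d) ∷ Q ⊎ B
    back′ (inj₁ v∈) = inj₁ (∈ᴾ-reverseHead v∈)
    back′ (inj₂ b)  = inj₂ b

  swapOnePair : ∀ x z c d Q → Valid ((c , d) ∷ Q) → x ∉ᴾ (c , d) ∷ Q → z ∉ᴾ (c , d) ∷ Q →
    x ≢ z → G x c ≡ false → G z d ≡ false → Σ Pairing (Absorbs ((c , d) ∷ Q) x z)
  swapOnePair x z c d Q (c≢d , c∉ , d∉ , _ , validQ) x∉ z∉ x≢z ¬xc ¬zd =
    ((x , c) ∷ (z , d) ∷ Q) ,
    ( (λ x≡c → x∉ (inj₁ x≡c))
    , ∉ᴾ-∷ x≢z (λ x≡d → x∉ (inj₂ (inj₁ x≡d))) (λ x∈Q → x∉ (inj₂ (inj₂ x∈Q)))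
    , ∉ᴾ-∷ (λ c≡z → z∉ (inj₁ (sym c≡z))) c≢d c∉
    , ¬xc
    , (λ z≡d → z∉ (inj₂ (inj₁ z≡d)))
    , (λ z∈Q → z∉ (inj₂ (inj₂ z∈Q)))
    , d∉ , ¬zd , validQ )
    , back , forth , inj₁ refl , inj₂ (inj₂ (inj₁ refl))
    where
    back : ∀ v → v ∈ᴾ (x , c) ∷ (z , d) ∷ Q → v ∈ᴾ (c , d) ∷ Q ⊎ v ≡ x ⊎ v ≡ z
    back v (inj₁ v≡x)                      = inj₂ (inj₁ v≡x)
    back v (inj₂ (inj₁ v≡c))               = inj₁ (inj₁ v≡c)
    back v (inj₂ (inj₂ (inj₁ v≡z)))        = inj₂ (inj₂ v≡z)
    back v (inj₂ (inj₂ (inj₂ (inj₁ v≡d)))) = inj₁ (inj₂ (inj₁ v≡d))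
    back v (inj₂ (inj₂ (inj₂ (inj₂ v∈Q)))) = inj₁ (inj₂ (inj₂ v∈Q))
    forth : ∀ v → v ∈ᴾ (c , d) ∷ Q → v ∈ᴾ (x , c) ∷ (z , d) ∷ Q
    forth v (inj₁ v≡c)        = inj₂ (inj₁ v≡c)
    forth v (inj₂ (inj₁ v≡d)) = inj₂ (inj₂ (inj₂ (inj₁ v≡d)))
    forth v (inj₂ (inj₂ v∈Q)) = inj₂ (inj₂ (inj₂ (inj₂ v∈Q)))

  -- If a ~ b, a is adjacent to e and f, and b to c and d, the pairs
  -- (c, d), (e, f) may be replaced by (a, c), (b, e), (f, d): a ≁ c and
  -- b ≁ e since G has no triangles, f ≁ d since a f d b is no 4-cycle.
  swapTwoPairs-valid : ∀ a b c d e f Q → Valid ((c , d) ∷ (e , f) ∷ Q) →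
    a ∉ᴾ (c , d) ∷ (e , f) ∷ Q → b ∉ᴾ (c , d) ∷ (e , f) ∷ Q → a ≢ b →
    G a b ≡ true → G a e ≡ true → G a f ≡ true → G b c ≡ true → G b d ≡ true →
    Valid ((a , c) ∷ (b , e) ∷ (f , d) ∷ Q)
  swapTwoPairs-valid a b c d e f Q (c≢d , c∉ , d∉ , _ , e≢f , e∉ , f∉ , _ , validQ) a∉ b∉ a≢b ab ae af bc bd =
      (λ a≡c → a∉ (inj₁ a≡c))
    , ∉ᴾ-∷ a≢b (λ a≡e → a∉ (inj₂ (inj₂ (inj₁ a≡e))))
        (∉ᴾ-∷ (λ a≡f → a∉ (inj₂ (inj₂ (inj₂ (inj₁ a≡f))))) (λ a≡d → a∉ (inj₂ (inj₁ a≡d)))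
              (λ a∈Q → a∉ (inj₂ (inj₂ (inj₂ (inj₂ a∈Q))))))
    , ∉ᴾ-∷ (λ c≡b → b∉ (inj₁ (sym c≡b))) (λ c≡e → c∉ (inj₁ c≡e))
        (∉ᴾ-∷ (λ c≡f → c∉ (inj₂ (inj₁ c≡f))) c≢d (λ c∈Q → c∉ (inj₂ (inj₂ c∈Q))))
    , ≢true⇒false (λ ac → triangle-free a b c ab bc (trans (G-sym c a) ac))
    , (λ b≡e → b∉ (inj₂ (inj₂ (inj₁ b≡e))))
    , ∉ᴾ-∷ (λ b≡f → b∉ (inj₂ (inj₂ (inj₂ (inj₁ b≡f))))) (λ b≡d → b∉ (inj₂ (inj₁ b≡d)))
        (λ b∈Q → b∉ (inj₂ (inj₂ (inj₂ (inj₂ b∈Q)))))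
    , ∉ᴾ-∷ e≢f (λ e≡d → d∉ (inj₁ (sym e≡d))) e∉
    , ≢true⇒false (λ be → triangle-free b a e (trans (G-sym b a) ab) ae (trans (G-sym e b) be))
    , (λ f≡d → d∉ (inj₂ (inj₁ (sym f≡d))))
    , f∉ , (λ d∈Q → d∉ (inj₂ (inj₂ d∈Q)))
    , ≢true⇒false (λ fd → square-free a f d b (λ a≡d → a∉ (inj₂ (inj₁ a≡d)))
                         (λ f≡b → b∉ (inj₂ (inj₂ (inj₂ (inj₁ (sym f≡b))))))
                         af fd (trans (G-sym d b) bd) (trans (G-sym b a) ab))
    , validQ

  swapTwoPairs : ∀ a b c d e f Q → Valid ((c , d) ∷ (e , f) ∷ Q) →
    a ∉ᴾ (c , d) ∷ (e , f) ∷ Q → b ∉ᴾ (c , d) ∷ (e , f) ∷ Q → a ≢ b →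
    G a b ≡ true → G a e ≡ true → G a f ≡ true → G b c ≡ true → G b d ≡ true →
    Σ Pairing (Absorbs ((c , d) ∷ (e , f) ∷ Q) a b)
  swapTwoPairs a b c d e f Q valid a∉ b∉ a≢b ab ae af bc bd =
    ((a , c) ∷ (b , e) ∷ (f , d) ∷ Q) ,
    swapTwoPairs-valid a b c d e f Q valid a∉ b∉ a≢b ab ae af bc bd ,
    back , forth , inj₁ refl , inj₂ (inj₂ (inj₁ refl))
    where
    back : ∀ v → v ∈ᴾ (a , c) ∷ (b , e) ∷ (f , d) ∷ Q → v ∈ᴾ (c , d) ∷ (e , f) ∷ Q ⊎ v ≡ a ⊎ v ≡ b
    back v (inj₁ v≡a)                                    = inj₂ (inj₁ v≡a)
    back v (inj₂ (inj₁ v≡c))                             = inj₁ (inj₁ v≡c)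
    back v (inj₂ (inj₂ (inj₁ v≡b)))                      = inj₂ (inj₂ v≡b)
    back v (inj₂ (inj₂ (inj₂ (inj₁ v≡e))))               = inj₁ (inj₂ (inj₂ (inj₁ v≡e)))
    back v (inj₂ (inj₂ (inj₂ (inj₂ (inj₁ v≡f)))))        = inj₁ (inj₂ (inj₂ (inj₂ (inj₁ v≡f))))
    back v (inj₂ (inj₂ (inj₂ (inj₂ (inj₂ (inj₁ v≡d)))))) = inj₁ (inj₂ (inj₁ v≡d))
    back v (inj₂ (inj₂ (inj₂ (inj₂ (inj₂ (inj₂ v∈Q)))))) = inj₁ (inj₂ (inj₂ (inj₂ (inj₂ v∈Q))))
    forth : ∀ v → v ∈ᴾ (c , d) ∷ (e , f) ∷ Q → v ∈ᴾ (a , c) ∷ (b , e) ∷ (f , d) ∷ Q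
    forth v (inj₁ v≡c)                      = inj₂ (inj₁ v≡c)
    forth v (inj₂ (inj₁ v≡d))               = inj₂ (inj₂ (inj₂ (inj₂ (inj₂ (inj₁ v≡d)))))
    forth v (inj₂ (inj₂ (inj₁ v≡e)))        = inj₂ (inj₂ (inj₂ (inj₁ v≡e)))
    forth v (inj₂ (inj₂ (inj₂ (inj₁ v≡f)))) = inj₂ (inj₂ (inj₂ (inj₂ (inj₁ v≡f))))
    forth v (inj₂ (inj₂ (inj₂ (inj₂ v∈Q)))) = inj₂ (inj₂ (inj₂ (inj₂ (inj₂ (inj₂ v∈Q)))))

  -- For adjacent x, z and any pair (c, d): one of the two crosswise swaps
  -- is available, or one of x, z is adjacent to both c and d (a mixed
  -- pattern would close a triangle).
  classify : ∀ x z c d → G x z ≡ true →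
      (G x c ≡ false × G z d ≡ false) ⊎ (G x d ≡ false × G z c ≡ false)
    ⊎ (G x c ≡ true × G x d ≡ true) ⊎ (G z c ≡ true × G z d ≡ true)
  classify x z c d xz with G x c in xc | G z d in zd | G x d in xd | G z c in zc
  ... | false | false | _     | _     = inj₁ (refl , refl)
  ... | _     | _     | false | false = inj₂ (inj₁ (refl , refl))
  ... | true  | _     | true  | _     = inj₂ (inj₂ (inj₁ (refl , refl)))
  ... | _     | true  | _     | true  = inj₂ (inj₂ (inj₂ (refl , refl)))
  ... | true  | false | false | true  = ⊥-elim (triangle-free x z c xz zc (trans (G-sym c x) xc))
  ... | false | true  | true  | false = ⊥-elim (triangle-free x z d xz zd (trans (G-sym d x) xd))

  absorbs-∷ : ∀ {c d Q x z P′} → Valid ((c , d) ∷ Q) → x ∉ᴾ (c , d) ∷ Q → z ∉ᴾ (c , d) ∷ Q →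
    Absorbs Q x z P′ → Absorbs ((c , d) ∷ Q) x z ((c , d) ∷ P′)
  absorbs-∷ {c} {d} {Q} {x} {z} {P′} (c≢d , c∉ , d∉ , ¬cd , _) x∉ z∉ (valid , back , forth , x∈ , z∈) =
    (c≢d , ∉P′ c∉ (λ c≡x → x∉ (inj₁ (sym c≡x))) (λ c≡z → z∉ (inj₁ (sym c≡z)))
         , ∉P′ d∉ (λ d≡x → x∉ (inj₂ (inj₁ (sym d≡x)))) (λ d≡z → z∉ (inj₂ (inj₁ (sym d≡z))))
         , ¬cd , valid)
    , back′ , forth′ , inj₂ (inj₂ x∈) , inj₂ (inj₂ z∈)
    where
    ∉P′ : ∀ {u} → u ∉ᴾ Q → u ≢ x → u ≢ z → u ∉ᴾ P′
    ∉P′ u∉Q u≢x u≢z u∈P′ with back _ u∈P′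
    ... | inj₁ u∈Q        = u∉Q u∈Q
    ... | inj₂ (inj₁ u≡x) = u≢x u≡x
    ... | inj₂ (inj₂ u≡z) = u≢z u≡z
    back′ : ∀ v → v ∈ᴾ (c , d) ∷ P′ → v ∈ᴾ (c , d) ∷ Q ⊎ v ≡ x ⊎ v ≡ z
    back′ v (inj₁ v≡c)         = inj₁ (inj₁ v≡c)
    back′ v (inj₂ (inj₁ v≡d))  = inj₁ (inj₂ (inj₁ v≡d))
    back′ v (inj₂ (inj₂ v∈P′)) with back v v∈P′
    ... | inj₁ v∈Q = inj₁ (inj₂ (inj₂ v∈Q))
    ... | inj₂ v≡  = inj₂ v≡
    forth′ : ∀ v → v ∈ᴾ (c , d) ∷ Q → v ∈ᴾ (c , d) ∷ P′
    forth′ v (inj₁ v≡c)        = inj₁ v≡c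
    forth′ v (inj₂ (inj₁ v≡d)) = inj₂ (inj₁ v≡d)
    forth′ v (inj₂ (inj₂ v∈Q)) = inj₂ (inj₂ (forth v v∈Q))

  adjacentToAll-∷ : ∀ {y c d Q} → G y c ≡ true → G y d ≡ true → AdjacentToAll y Q →
    AdjacentToAll y ((c , d) ∷ Q)
  adjacentToAll-∷ yc yd yQ v (inj₁ refl)        = yc
  adjacentToAll-∷ yc yd yQ v (inj₂ (inj₁ refl)) = yd
  adjacentToAll-∷ yc yd yQ v (inj₂ (inj₂ v∈Q))  = yQ v v∈Q

  absorbMixed : ∀ x z c d Q → Valid ((c , d) ∷ Q) → x ∉ᴾ (c , d) ∷ Q → z ∉ᴾ (c , d) ∷ Q →
    x ≢ z → G x z ≡ true → AdjacentToAll x Q → G z c ≡ true → G z d ≡ true →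
    AbsorbResult ((c , d) ∷ Q) x z
  absorbMixed x z c d [] _ _ _ _ _ _ zc zd = inj₂ (inj₂ (adjacentToAll-∷ zc zd (λ v ())))
  absorbMixed x z c d ((e , f) ∷ Q) valid x∉ z∉ x≢z xz xQ zc zd =
    inj₁ (swapTwoPairs x z c d e f Q valid x∉ z∉ x≢z xz (xQ e (inj₁ refl)) (xQ f (inj₂ (inj₁ refl))) zc zd)

  absorbPast : ∀ x z c d Q → Valid ((c , d) ∷ Q) → x ∉ᴾ (c , d) ∷ Q → z ∉ᴾ (c , d) ∷ Q →
    x ≢ z → G x z ≡ true → (G x c ≡ true × G x d ≡ true) ⊎ (G z c ≡ true × G z d ≡ true) →
    AbsorbResult Q x z → AbsorbResult ((c , d) ∷ Q) x z
  absorbPast x z c d Q valid x∉ z∉ _ _ _ (inj₁ (P′ , absorbs)) = inj₁ (_ , absorbs-∷ valid x∉ z∉ absorbs)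
  absorbPast x z c d Q _ _ _ _ _ (inj₁ (xc , xd)) (inj₂ (inj₁ xQ)) = inj₂ (inj₁ (adjacentToAll-∷ xc xd xQ))
  absorbPast x z c d Q _ _ _ _ _ (inj₂ (zc , zd)) (inj₂ (inj₂ zQ)) = inj₂ (inj₂ (adjacentToAll-∷ zc zd zQ))
  absorbPast x z c d Q valid x∉ z∉ x≢z xz (inj₂ (zc , zd)) (inj₂ (inj₁ xQ)) =
    absorbMixed x z c d Q valid x∉ z∉ x≢z xz xQ zc zd
  absorbPast x z c d Q valid x∉ z∉ x≢z xz (inj₁ (xc , xd)) (inj₂ (inj₂ zQ)) =
    absorbResult-flip
      (absorbMixed z x c d Q valid z∉ x∉ (λ z≡x → x≢z (sym z≡x)) (trans (G-sym z x) xz) zQ xc xd)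

  absorb : ∀ P x z → Valid P → x ∉ᴾ P → z ∉ᴾ P → x ≢ z → G x z ≡ true → AbsorbResult P x z
  absorb [] x z _ _ _ _ _ = inj₂ (inj₁ (λ v ()))
  absorb ((c , d) ∷ Q) x z valid x∉ z∉ x≢z xz with classify x z c d xz
  ... | inj₁ (¬xc , ¬zd) = inj₁ (swapOnePair x z c d Q valid x∉ z∉ x≢z ¬xc ¬zd)
  ... | inj₂ (inj₁ (¬xd , ¬zc)) = inj₁ (map₂ absorbs-reverseHead
          (swapOnePair x z d c Q (valid-reverseHead valid) (λ x∈ → x∉ (∈ᴾ-reverseHead x∈))
                       (λ z∈ → z∉ (∈ᴾ-reverseHead z∈)) x≢z ¬xd ¬zc))
  ... | inj₂ (inj₂ oneAdjacentToBoth) =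
    absorbPast x z c d Q valid x∉ z∉ x≢z xz oneAdjacentToBoth
      (absorb Q x z (proj₂ (proj₂ (proj₂ (proj₂ valid)))) (λ x∈Q → x∉ (inj₂ (inj₂ x∈Q)))
              (λ z∈Q → z∉ (inj₂ (inj₂ z∈Q))) x≢z xz)

  Within : Pairing → List (Fin N) → Set
  Within P L = ∀ v → v ∈ᴾ P → v ∈ L

  AlmostCovers : Pairing → List (Fin N) → Set
  AlmostCovers P L = (∀ v → v ∈ L → v ∈ᴾ P) ⊎ Σ (Fin N) λ z → z ∈ L × z ∉ᴾ P × CoversBut P L z

  Dominates : Fin N → List (Fin N) → Set
  Dominates y L = ∀ v → v ∈ L → v ≢ y → G y v ≡ true

  NearPerfectOrDominated : List (Fin N) → Set
  NearPerfectOrDominated L = (Σ Pairing λ P → Valid P × Within P L × AlmostCovers P L)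
                           ⊎ (Σ (Fin N) λ y → y ∈ L × Dominates y L)

  dominated-independent : ∀ {y L} → Dominates y L →
    ∀ u v → u ∈ L → v ∈ L → u ≢ y → v ≢ y → G u v ≡ false
  dominated-independent {y} y-dom u v u∈ v∈ u≢y v≢y = ≢true⇒false λ uv →
    triangle-free y u v (y-dom u u∈ u≢y) uv (trans (G-sym v y) (y-dom v v∈ v≢y))

  addPair : ∀ {x w L P} → x ∉ L → w ∈ L → Valid P → (∀ v → v ∈ᴾ P → v ∈ L × v ≢ w) →
    G x w ≡ false → AlmostCoversBut P L w →
    Σ Pairing λ P′ → Valid P′ × Within P′ (x ∷ L) × AlmostCovers P′ (x ∷ L)
  addPair {x} {w} {L} {P} x∉L w∈L valid within ¬xw almost =
    ((x , w) ∷ P) ,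
    ( ∉-∈⇒≢ x∉L w∈L , (λ x∈P → x∉L (proj₁ (within x x∈P))) , (λ w∈P → proj₂ (within w w∈P) refl)
    , ¬xw , valid ) ,
    within′ , covers almost
    where
    within′ : Within ((x , w) ∷ P) (x ∷ L)
    within′ v (inj₁ v≡x)        = here v≡x
    within′ v (inj₂ (inj₁ v≡w)) = there (subst (_∈ L) (sym v≡w) w∈L)
    within′ v (inj₂ (inj₂ v∈P)) = there (proj₁ (within v v∈P))
    orPartner : ∀ v → (v ≢ w → v ∈ᴾ P) → v ∈ᴾ (x , w) ∷ P
    orPartner v v∈P with v ≟ w
    ... | yes v≡w = inj₂ (inj₁ v≡w)
    ... | no v≢w  = inj₂ (inj₂ (v∈P v≢w))
    covers : AlmostCoversBut P L w → AlmostCovers ((x , w) ∷ P) (x ∷ L)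
    covers (inj₁ rest) = inj₁ λ where
      v (here v≡x) → inj₁ v≡x
      v (there v∈) → orPartner v (λ v≢w → rest v v∈ v≢w)
    covers (inj₂ (z , z∈ , z≢w , z∉ , rest)) =
      inj₂ (z , there z∈ , ∉ᴾ-∷ (λ z≡x → ∉-∈⇒≢ x∉L z∈ (sym z≡x)) z≢w z∉ , λ where
        v (here v≡x) _   → inj₁ v≡x
        v (there v∈) v≢z → orPartner v (λ v≢w → rest v v∈ v≢w v≢z))

  -- Adding x when y dominates L: y may dominate x ∷ L as well; otherwise
  -- x is paired with y and the remaining (independent) vertices greedily.
  extendDominated : ∀ x L y → x ∉ L → Unique L → y ∈ L → Dominates y L → NearPerfectOrDominated (x ∷ L)
  extendDominated x L y x∉L uL y∈L y-dom with G y x in yx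
  ... | true = inj₂ (y , there y∈L , λ where
          v (here refl) _  → yx
          v (there v∈) v≢y → y-dom v v∈ v≢y)
  ... | false with pairIndependent L y uL (dominated-independent y-dom)
  ...   | P , valid , within , almost = inj₁ (addPair x∉L y∈L valid within (trans (G-sym x y) yx) almost)

  extendCovered : ∀ x L P → x ∉ L → Valid P → Within P L → (∀ v → v ∈ L → v ∈ᴾ P) →
    NearPerfectOrDominated (x ∷ L)
  extendCovered x L P x∉L valid within all =
    inj₁ (P , valid , (λ v v∈P → there (within v v∈P)) ,
          inj₂ (x , here refl , (λ x∈P → x∉L (within x x∈P)) , λ where
            v (here v≡x) v≢x → ⊥-elim (v≢x v≡x)
            v (there v∈) _   → all v v∈))

  absorbs-covers : ∀ {x z L P P′} → Within P L → z ∈ L → CoversBut P L z → Absorbs P x z P′ →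
    Within P′ (x ∷ L) × (∀ v → v ∈ x ∷ L → v ∈ᴾ P′)
  absorbs-covers {x} {z} {L} {P} {P′} within z∈ rest (_ , back , forth , x∈ , z∈′) = within′ , covers
    where
    within′ : Within P′ (x ∷ L)
    within′ v v∈ with back v v∈
    ... | inj₁ v∈P        = there (within v v∈P)
    ... | inj₂ (inj₁ v≡x) = here v≡x
    ... | inj₂ (inj₂ v≡z) = there (subst (_∈ L) (sym v≡z) z∈)
    covers : ∀ v → v ∈ x ∷ L → v ∈ᴾ P′
    covers v (here refl) = x∈
    covers v (there v∈) with v ≟ z
    ... | yes refl = z∈′
    ... | no v≢z   = forth v (rest v v∈ v≢z)

  adjacentToAll-L : ∀ {y z L P} → AdjacentToAll y P → CoversBut P L z → G y z ≡ true →
    ∀ v → v ∈ L → G y v ≡ true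
  adjacentToAll-L {z = z} yP rest yz v v∈ with v ≟ z
  ... | yes refl = yz
  ... | no v≢z   = yP v (rest v v∈ v≢z)

  extendMissing : ∀ x L P z → x ∉ L → Valid P → Within P L → z ∈ L → z ∉ᴾ P → CoversBut P L z →
    NearPerfectOrDominated (x ∷ L)
  extendMissing x L P z x∉L valid within z∈ z∉ rest with G x z in xz
  ... | false =
    inj₁ (addPair x∉L z∈ valid (λ v v∈P → within v v∈P , λ { refl → z∉ v∈P }) xz (inj₁ rest))
  ... | true with absorb P x z valid (λ x∈P → x∉L (within x x∈P)) z∉ (∉-∈⇒≢ x∉L z∈) xz
  ...   | inj₁ (P′ , absorbs) =
    inj₁ (P′ , proj₁ absorbs , map₂ inj₁ (absorbs-covers within z∈ rest absorbs))
  ...   | inj₂ (inj₁ xP) = inj₂ (x , here refl , λ where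
            v (here v≡x) v≢x → ⊥-elim (v≢x v≡x)
            v (there v∈) _   → adjacentToAll-L xP rest xz v v∈)
  ...   | inj₂ (inj₂ zP) = inj₂ (z , there z∈ , λ where
            v (here refl) _  → trans (G-sym z v) xz
            v (there v∈) v≢z → zP v (rest v v∈ v≢z))

  nearPerfect : ∀ L → Unique L → NearPerfectOrDominated L
  nearPerfect []      _  = inj₁ ([] , tt , (λ v ()) , inj₁ (λ v ()))
  nearPerfect (x ∷ L) uxL@(_ ∷ uL) with nearPerfect L uL
  ... | inj₂ (y , y∈L , y-dom) = extendDominated x L y (head∉tail uxL) uL y∈L y-dom
  ... | inj₁ (P , valid , within , inj₁ all) = extendCovered x L P (head∉tail uxL) valid within all
  ... | inj₁ (P , valid , within , inj₂ (z , z∈ , z∉ , rest)) =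
    extendMissing x L P z (head∉tail uxL) valid within z∈ z∉ rest

IsStarCentre : ∀ {n} → Graph n → Fin n → Set
IsStarCentre G c = (∀ v → v ≢ c → Adj G c v) × (∀ u v → u ≢ c → v ≢ c → adj G u v ≡ false)

star-centre : ∀ m → IsStarCentre (star m) fz
star-centre m = dominating , independent
  where
  dominating : ∀ v → v ≢ fz → Adj (star m) fz v
  dominating fz     v≢fz = ⊥-elim (v≢fz refl)
  dominating (fs v) _    = refl
  independent : ∀ u v → u ≢ fz → v ≢ fz → adj (star m) u v ≡ false
  independent fz     _      u≢fz _    = ⊥-elim (u≢fz refl)
  independent (fs u) fz     _    v≢fz = ⊥-elim (v≢fz refl)
  independent (fs u) (fs v) _    _    = refl

centre-transport : ∀ {n} {G H : Graph n} {c d} → IsStarCentre G c → IsStarCentre H d →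
  (f : Fin n → Fin n) → f c ≡ d → (∀ v → v ≢ c → f v ≢ d) → ∀ i j → adj G i j ≡ adj H (f i) (f j)
centre-transport {G = G} {H} {c} {d} (G-dom , G-indep) (H-dom , H-indep) f fc≡d f-≢ i j
  with i ≟ c | j ≟ c
... | yes refl | yes refl = trans (adjIrr G c) (sym (adjIrr H (f c)))
... | yes refl | no j≢c   rewrite fc≡d = trans (G-dom j j≢c) (sym (H-dom (f j) (f-≢ j j≢c)))
... | no i≢c   | yes refl rewrite fc≡d =
  trans (adjSym G i c) (trans (G-dom i i≢c) (sym (trans (adjSym H (f i) d) (H-dom (f i) (f-≢ i i≢c)))))
... | no i≢c   | no j≢c   = trans (G-indep i j i≢c j≢c) (sym (H-indep (f i) (f j) (f-≢ i i≢c) (f-≢ j j≢c)))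

transpose-source : ∀ {n} (i j : Fin n) → PC.transpose i j i ≡ j
transpose-source i j rewrite dec-true (i ≟ i) refl = refl

centre⇒≅star : ∀ {m} (G : Graph (suc m)) c → IsStarCentre G c → G ≅ star m
centre⇒≅star {m} G c centre =
  σ , centre-transport {G = G} {star m} centre (star-centre m) (Inverse.to σ) (transpose-source c fz) moves-off-fz
  where
  σ : Fin (suc m) ↔ Fin (suc m)
  σ = transpose c fz
  moves-off-fz : ∀ v → v ≢ c → Inverse.to σ v ≢ fz
  moves-off-fz v v≢c σv≡fz = v≢c (begin
    v                               ≡⟨ Inverse.strictlyInverseʳ σ v ⟨
    Inverse.from σ (Inverse.to σ v) ≡⟨ cong (Inverse.from σ) σv≡fz ⟩
    Inverse.from σ fz               ≡⟨ transpose-source fz c ⟩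
    c                               ∎)
    where open ≡-Reasoning

≅star⇒centre : ∀ {m} (G : Graph (suc m)) → ((σ , _) : G ≅ star m) → IsStarCentre G (Inverse.from σ fz)
≅star⇒centre {m} G (σ , preserves) = dominating , independent
  where
  to = Inverse.to σ
  from = Inverse.from σ
  c = from fz
  to-c : to c ≡ fz
  to-c = Inverse.strictlyInverseˡ σ fz
  to-≢ : ∀ v → v ≢ c → to v ≢ fz
  to-≢ v v≢c tv≡fz = v≢c (trans (sym (Inverse.strictlyInverseʳ σ v)) (cong from tv≡fz))
  dominating : ∀ v → v ≢ c → Adj G c v
  dominating v v≢c = trans (preserves c v)
    (trans (cong (λ x → adj (star m) x (to v)) to-c) (proj₁ (star-centre m) (to v) (to-≢ v v≢c)))
  independent : ∀ u v → u ≢ c → v ≢ c → adj G u v ≡ false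
  independent u v u≢c v≢c =
    trans (preserves u v) (proj₂ (star-centre m) (to u) (to v) (to-≢ u u≢c) (to-≢ v v≢c))

module StarMatchings {m} (G : Graph (suc m)) (c : Fin (suc m)) (centre : IsStarCentre G c) where

  open Pairings (adj G) (adjSym G)

  matched-to-centre : (M : Matching (adj G)) → ∀ u w → u ≢ c → partner M u ≡ just w → w ≡ c
  matched-to-centre M u w u≢c pu with w ≟ c
  ... | yes w≡c = w≡c
  ... | no w≢c  = ⊥-elim (true≢false (trans (sym (isEdge M u w pu)) (proj₂ centre u w u≢c w≢c)))

  noPM : ∀ u v → u ≢ c → v ≢ c → u ≢ v → ¬ HasPM (adj G)
  noPM u v u≢c v≢c u≢v (M , perfect) with perfect u | perfect v
  ... | w , pu | w′ , pv with matched-to-centre M u w u≢c pu | matched-to-centre M v w′ v≢c pv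
  ...   | refl | refl = u≢v (just-injective (trans (sym (involut M u c pu)) (involut M v c pv)))

  -- The centre is isolated in the complement.
  complement-noPM : ¬ HasPM (adj (complement G))
  complement-noPM (M , perfect) with perfect c
  ... | w , pc = true≢false (trans (sym cw) (complement-nonadj G c w (proj₁ centre w w≢c)))
    where
    cw = isEdge M c w pc
    w≢c : w ≢ c
    w≢c w≡c = adjacent-≢ (complement G) cw (sym w≡c)

  -- The leaves are pairwise non-adjacent, i.e. a clique in the
  -- complement; pairing them greedily gives an almost-perfect matching
  -- missing c, unless a second leaf z is left over and n is even.
  evenFromLeafPairing : ∀ P → Valid P → c ∉ᴾ P → AlmostCoversBut P (allFin (suc m)) c →
    ¬ HasAPM (adj (complement G)) → Even (suc m)
  evenFromLeafPairing P valid c∉P (inj₁ covers) noAPM =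
    ⊥-elim (noAPM (M , c , partnerIn-∉ P c c∉P , λ v v≢c → partnerIn-∈ P v (covers v (∈-allFin v) v≢c)))
    where M = toMatching (complement-adj G) P valid
  evenFromLeafPairing P valid c∉P (inj₂ (z , _ , z≢c , z∉P , covers)) _ =
    missingTwo⇒even (complement G) M c z z≢c (partnerIn-∉ P c c∉P) (partnerIn-∉ P z z∉P)
      λ v v≢c v≢z → partnerIn-∈ P v (covers v (∈-allFin v) v≢c v≢z)
    where M = toMatching (complement-adj G) P valid

  complement-noAPM⇒even : ¬ HasAPM (adj (complement G)) → Even (suc m)
  complement-noAPM⇒even with pairIndependent (allFin (suc m)) c (allFin⁺ (suc m)) (λ u v _ _ → proj₂ centre u v)
  ... | P , valid , within , covered = evenFromLeafPairing P valid (λ c∈P → proj₂ (within c c∈P) refl) covered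

from-injective : ∀ {n} (σ : Fin n ↔ Fin n) {x y} → Inverse.from σ x ≡ Inverse.from σ y → x ≡ y
from-injective σ {x} {y} σx≡σy =
  trans (sym (Inverse.strictlyInverseˡ σ x)) (trans (cong (Inverse.to σ) σx≡σy) (Inverse.strictlyInverseˡ σ y))

-- A graph isomorphic to a star with at least two leaves has no perfect
-- matching: the preimages of fs fz and fs (fs fz) are distinct leaves.
≅star⇒noPM : ∀ {k} (G : Graph (3 + k)) → G ≅ star (2 + k) → ¬ HasPM (adj G)
≅star⇒noPM G iso@(σ , _) =
  noPM (Inverse.from σ (fs fz)) (Inverse.from σ (fs (fs fz)))
    (λ e → Fin.0≢1+n (sym (from-injective σ e)))
    (λ e → Fin.0≢1+n (sym (from-injective σ e)))
    (λ e → Fin.0≢1+n (Fin.suc-injective (from-injective σ e)))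
  where open StarMatchings G (Inverse.from σ fz) (≅star⇒centre G iso)

≅star⇒complement-noPM : ∀ {m} (G : Graph (suc m)) → G ≅ star m → ¬ HasPM (adj (complement G))
≅star⇒complement-noPM G iso@(σ , _) = StarMatchings.complement-noPM G (Inverse.from σ fz) (≅star⇒centre G iso)

module AcyclicGraph {n} (G : Graph n) (acyclic : Acyclic G) where

  triangle-free : ∀ a b c → Adj G a b → Adj G b c → Adj G c a → ⊥
  triangle-free a b c ab bc ca = acyclic record { k = 0 ; c = vertex ; inj = injective ; edges = edge }
    where
    vertex : Fin 3 → Fin n
    vertex fz           = a
    vertex (fs fz)      = b
    vertex (fs (fs fz)) = c
    injective : ∀ i j → vertex i ≡ vertex j → i ≡ j
    injective fz           fz           _   = refl
    injective fz           (fs fz)      a≡b = ⊥-elim (adjacent-≢ G ab a≡b)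
    injective fz           (fs (fs fz)) a≡c = ⊥-elim (adjacent-≢ G ca (sym a≡c))
    injective (fs fz)      fz           b≡a = ⊥-elim (adjacent-≢ G ab (sym b≡a))
    injective (fs fz)      (fs fz)      _   = refl
    injective (fs fz)      (fs (fs fz)) b≡c = ⊥-elim (adjacent-≢ G bc b≡c)
    injective (fs (fs fz)) fz           c≡a = ⊥-elim (adjacent-≢ G ca c≡a)
    injective (fs (fs fz)) (fs fz)      c≡b = ⊥-elim (adjacent-≢ G bc (sym c≡b))
    injective (fs (fs fz)) (fs (fs fz)) _   = refl
    edge : ∀ i → Adj G (vertex i) (vertex _)
    edge fz           = ab
    edge (fs fz)      = bc
    edge (fs (fs fz)) = ca

  square-free : ∀ a b c d → a ≢ c → b ≢ d →
    Adj G a b → Adj G b c → Adj G c d → Adj G d a → ⊥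
  square-free a b c d a≢c b≢d ab bc cd da =
    acyclic record { k = 1 ; c = vertex ; inj = injective ; edges = edge }
    where
    vertex : Fin 4 → Fin n
    vertex fz                = a
    vertex (fs fz)           = b
    vertex (fs (fs fz))      = c
    vertex (fs (fs (fs fz))) = d
    injective : ∀ i j → vertex i ≡ vertex j → i ≡ j
    injective fz                fz                _   = refl
    injective fz                (fs fz)           a≡b = ⊥-elim (adjacent-≢ G ab a≡b)
    injective fz                (fs (fs fz))      a≡c = ⊥-elim (a≢c a≡c)
    injective fz                (fs (fs (fs fz))) a≡d = ⊥-elim (adjacent-≢ G da (sym a≡d))
    injective (fs fz)           fz                b≡a = ⊥-elim (adjacent-≢ G ab (sym b≡a))
    injective (fs fz)           (fs fz)           _   = refl
    injective (fs fz)           (fs (fs fz))      b≡c = ⊥-elim (adjacent-≢ G bc b≡c)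
    injective (fs fz)           (fs (fs (fs fz))) b≡d = ⊥-elim (b≢d b≡d)
    injective (fs (fs fz))      fz                c≡a = ⊥-elim (a≢c (sym c≡a))
    injective (fs (fs fz))      (fs fz)           c≡b = ⊥-elim (adjacent-≢ G bc (sym c≡b))
    injective (fs (fs fz))      (fs (fs fz))      _   = refl
    injective (fs (fs fz))      (fs (fs (fs fz))) c≡d = ⊥-elim (adjacent-≢ G cd c≡d)
    injective (fs (fs (fs fz))) fz                d≡a = ⊥-elim (adjacent-≢ G da d≡a)
    injective (fs (fs (fs fz))) (fs fz)           d≡b = ⊥-elim (b≢d (sym d≡b))
    injective (fs (fs (fs fz))) (fs (fs fz))      d≡c = ⊥-elim (adjacent-≢ G cd (sym d≡c))
    injective (fs (fs (fs fz))) (fs (fs (fs fz))) _   = refl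
    edge : ∀ i → Adj G (vertex i) (vertex _)
    edge fz                = ab
    edge (fs fz)           = bc
    edge (fs (fs fz))      = cd
    edge (fs (fs (fs fz))) = da

  open Pairings (adj G) (adjSym G)
  open NearPerfect (adj G) (adjSym G) triangle-free square-free

  dominating⇒centre : ∀ c → (∀ v → v ≢ c → Adj G c v) → IsStarCentre G c
  dominating⇒centre c c-dom = c-dom , λ u v u≢c v≢c → ≢true⇒false λ uv →
    triangle-free c u v (c-dom u u≢c) uv (trans (adjSym G v c) (c-dom v v≢c))

  complementMatching-or-centre :
    HasPM (adj (complement G)) ⊎ HasAPM (adj (complement G)) ⊎ Σ (Fin n) (IsStarCentre G)
  complementMatching-or-centre with nearPerfect (allFin n) (allFin⁺ n)
  ... | inj₁ (P , valid , _ , inj₁ covers) =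
    inj₁ (toMatching (complement-adj G) P valid , λ v → partnerIn-∈ P v (covers v (∈-allFin v)))
  ... | inj₁ (P , valid , _ , inj₂ (z , _ , z∉P , covers)) =
    inj₂ (inj₁ (toMatching (complement-adj G) P valid , z , partnerIn-∉ P z z∉P ,
                λ v v≢z → partnerIn-∈ P v (covers v (∈-allFin v) v≢z)))
  ... | inj₂ (c , _ , c-dom) = inj₂ (inj₂ (c , dominating⇒centre c (λ v v≢c → c-dom v (∈-allFin v) v≢c)))

acyclic⇒evenStar : ∀ {m} (G : Graph (suc m)) → Acyclic G → NoPMnorAPM (adj (complement G)) →
  Even (suc m) × G ≅ star m
acyclic⇒evenStar G acyclic (noPM , noAPM) with AcyclicGraph.complementMatching-or-centre G acyclic
... | inj₁ pm                  = ⊥-elim (noPM pm)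
... | inj₂ (inj₁ apm)          = ⊥-elim (noAPM apm)
... | inj₂ (inj₂ (c , centre)) =
  StarMatchings.complement-noAPM⇒even G c centre noAPM , centre⇒≅star G c centre

-- Proposition 5.2 (the argument only needs n ≥ 3).  Backward: an even star has two leaves and its
-- complement an isolated vertex, so neither has a perfect matching, and
-- no graph of even order has an almost-perfect matching.
proposition5p2 : (m : ℕ) → 9 ≤ suc m → (T : Graph (suc m)) → IsTree T →
    ((IsMP T 0 × IsMP (complement T) 0) ⇔ (Even (suc m) × (T ≅ star m)))
proposition5p2 m (s≤s (s≤s (s≤s _))) T (_ , acyclic) = mk⇔ forward backward
  where
  mp-T  = mp-zero⇔noMatching T
  mp-T̄ = mp-zero⇔noMatching (complement T)

  forward : IsMP T 0 × IsMP (complement T) 0 → Even (suc m) × T ≅ star m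
  forward (_ , T̄-mp0) = acyclic⇒evenStar T acyclic (Equivalence.to mp-T̄ T̄-mp0)

  backward : Even (suc m) × T ≅ star m → IsMP T 0 × IsMP (complement T) 0
  backward (even , iso) =
    Equivalence.from mp-T  (≅star⇒noPM T iso , even⇒noAPM even T) ,
    Equivalence.from mp-T̄ (≅star⇒complement-noPM T iso , even⇒noAPM even (complement T))
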